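{- Let $(e_i \mid i\in\omega)$ be a sequence of events with $e_i<_0 e_j \iff i<j$, with predicates $\mathrm{Add},\mathrm{Rem},\mathrm{Cnt}$ and functions $\mathrm{val},\chi$ as in the context. In property FS1, the clause "there is no event $r$ with $\mathrm{Rem}^1(r)$, $\gamma(r)=\gamma(a)$ and $\gamma(a)<_0 r<_0 a$" is equivalent (in the presence of the remaining parts of FS0, FS1, FS2) to the seemingly stronger clause "there is no event $b$ with $\mathrm{Rem}(b)$, $\chi(b)\neq f$, $\gamma(a)<_0 b<_0 a$ and $\mathrm{val}(b)=\mathrm{val}(a)$". In particular, if $\gamma$ satisfies FS0, FS1 and FS2, then for every event $a$ with $\mathrm{Op}^1(a)$ there is no event $b$ with $\mathrm{Rem}(b)\wedge\chi(b)\neq f\wedge \gamma(a)<_0 b<_0 a\wedge \mathrm{val}(b)=\mathrm{val}(a)$.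
   Context: Setting (serial set object). We are given an infinite sequence of events $(e_i\mid i\in\omega)$, linearly ordered by $<_0$ where $e_i<_0 e_j$ iff $i<j$. Three unary predicates $\mathrm{Add},\mathrm{Rem},\mathrm{Cnt}$ partition the events. Each event $a$ has a key $\mathrm{val}(a)\in\mathbb N$ and a status $\chi(a)\in\{0,1,f\}$, where $\chi(a)\in\{0,1\}$ whenever $\mathrm{Cnt}(a)$. Shorthands: for $p\in\{0,1,f\}$, $\mathrm{Add}^p(a)$ means $\mathrm{Add}(a)\wedge\chi(a)=p$ and $\mathrm{Rem}^p(a)$ means $\mathrm{Rem}(a)\wedge\chi(a)=p$; for $p\in\{0,1\}$, $\mathrm{Op}^p(a)$ means $(\mathrm{Add}(a)\vee\mathrm{Rem}(a)\vee\mathrm{Cnt}(a))\wedge\chi(a)=p$. The properties of a function $\gamma$: FS0: $<_0$ is a linear ordering of the events; $\mathrm{Add},\mathrm{Rem},\mathrm{Cnt}$ are pairwise disjoint; $\gamma$ is defined on the set of $\mathrm{Op}^1$ events and its values are $\mathrm{Add}^0$ events. FS1: for every event $a$ with $\mathrm{Op}^1(a)$: $\gamma(a)<_0 a$, $\mathrm{Add}^0(\gamma(a))$, $\mathrm{val}(a)=\mathrm{val}(\gamma(a))$, and there is no event $r$ with $\mathrm{Rem}^1(r)$, $\gamma(r)=\gamma(a)$ and $\gamma(a)<_0 r<_0 a$. FS2: for all events $a<_0 b$ with $\mathrm{Add}^0(a)$, $\mathrm{Op}^0(b)$ and $\mathrm{val}(a)=\mathrm{val}(b)$, there is an event $r$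 with $a<_0 r<_0 b$, $\mathrm{Rem}^1(r)$ and $a=\gamma(r)$. -}

module Defs where

open import Data.Nat using (ℕ; _<_)
open import Data.Product using (_×_; ∃-syntax)
open import Relation.Binary.PropositionalEquality using (_≡_; _≢_)
open import Relation.Nullary using (¬_)

-- Events are e_i, identified with their index i ∈ ℕ; e_i <₀ e_j iff i < j.
-- The three predicates Add, Rem, Cnt partition the events: every event has
-- exactly one kind.
data Kind : Set where
  add rem cnt : Kind

data Status : Set where
  s0 s1 sf : Status

record History : Set where
  field
    kind : ℕ → Kind
    val  : ℕ → ℕ
    χ    : ℕ → Status
    cnt-status : ∀ a → kind a ≡ cnt → χ a ≢ sf

module _ (H : History) where
  open History H

  Add Rem Cnt : ℕ → Set
  Add a = kind a ≡ add
  Rem a = kind a ≡ rem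
  Cnt a = kind a ≡ cnt

  Add⁰ Rem¹ : ℕ → Set
  Add⁰ a = Add a × χ a ≡ s0
  Rem¹ a = Rem a × χ a ≡ s1

  -- Op^p(a): (Add ∨ Rem ∨ Cnt)(a) ∧ χ(a) = p; the disjunction always holds
  -- since the kinds partition the events.
  Op⁰ Op¹ : ℕ → Set
  Op⁰ a = χ a ≡ s0
  Op¹ a = χ a ≡ s1

  -- γ is given as a total function ℕ → ℕ; only its values on Op¹ events
  -- are constrained or used.

  -- FS0 (remaining content): values of γ on Op¹ events are Add⁰ events.
  FS0 : (ℕ → ℕ) → Set
  FS0 γ = ∀ a → Op¹ a → Add⁰ (γ a)

  FS1-base : (ℕ → ℕ) → Set
  FS1-base γ = ∀ a → Op¹ a → (γ a < a) × Add⁰ (γ a) × (val a ≡ val (γ a))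

  FS1-clause : (ℕ → ℕ) → Set
  FS1-clause γ = ∀ a → Op¹ a →
    ¬ (∃[ r ] (Rem¹ r × γ r ≡ γ a × γ a < r × r < a))

  FS1-clause-strong : (ℕ → ℕ) → Set
  FS1-clause-strong γ = ∀ a → Op¹ a →
    ¬ (∃[ b ] (Rem b × χ b ≢ sf × γ a < b × b < a × val b ≡ val a))

  FS1 : (ℕ → ℕ) → Set
  FS1 γ = FS1-base γ × FS1-clause γ

  FS2 : (ℕ → ℕ) → Set
  FS2 γ = ∀ a b → a < b → Add⁰ a → Op⁰ b → val a ≡ val b →
    ∃[ r ] (a < r × r < b × Rem¹ r × a ≡ γ r)

-- While the element added by γ(a) is present, i.e. strictly between γ(a)
-- and a, FS2 forbids any Op⁰ event on the same key: it would force a removal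
-- of γ(a) in that interval.  A Rem¹ event b with the same key inside the
-- interval therefore removes γ(a) itself: if γ(b) came earlier, γ(a) would be
-- an Op⁰ event inside the lifetime of γ(b); if later, γ(b) would be one inside
-- the lifetime of γ(a).
module Submission where

open import Defs
open import Data.Nat using (ℕ; _<_)
open import Data.Nat.Properties using (<-trans; <-cmp)
open import Data.Empty using (⊥; ⊥-elim)
open import Data.Product using (_×_; _,_; proj₁; proj₂)
open import Function.Bundles using (_⇔_; mk⇔)
open import Relation.Binary.Definitions using (tri<; tri≈; tri>)
open import Relation.Binary.PropositionalEquality using (_≡_; _≢_; refl; sym; trans; cong)

module _ (H : History) (γ : ℕ → ℕ) (base : FS1-base H γ) where
  open History H

  γ-<-self : ∀ a → Op¹ H a → γ a < a
  γ-<-self a op = proj₁ (base a op)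

  γ-Op⁰ : ∀ a → Op¹ H a → Op⁰ H (γ a)
  γ-Op⁰ a op = proj₂ (proj₁ (proj₂ (base a op)))

  val-γ : ∀ a → Op¹ H a → val (γ a) ≡ val a
  val-γ a op = sym (proj₂ (proj₂ (base a op)))

  FS1-clause-strong⇒FS1-clause : FS1-clause-strong H γ → FS1-clause H γ
  FS1-clause-strong⇒FS1-clause strong a op (r , (rem-r , op-r) , γr≡γa , γa<r , r<a) =
    strong a op (r , rem-r , s1≢sf op-r , γa<r , r<a , val-r≡val-a)
    where
    s1≢sf : χ r ≡ s1 → χ r ≢ sf
    s1≢sf p q with trans (sym p) q
    ... | ()

    val-r≡val-a : val r ≡ val a
    val-r≡val-a = trans (sym (val-γ r op-r)) (trans (cong val γr≡γa) (val-γ a op))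

  module _ (fs2 : FS2 H γ) (clause : FS1-clause H γ) where

    no-Op⁰-between-γ : ∀ a → Op¹ H a → ∀ b → γ a < b → b < a →
                       Op⁰ H b → val b ≡ val a → ⊥
    no-Op⁰-between-γ a op b γa<b b<a op⁰-b vb≡va
      with fs2 (γ a) b γa<b (proj₁ (proj₂ (base a op))) op⁰-b
               (trans (val-γ a op) (sym vb≡va))
    ... | r , γa<r , r<b , rem¹-r , γa≡γr =
      clause a op (r , rem¹-r , sym γa≡γr , γa<r , <-trans r<b b<a)

    γ-unique-between-γ : ∀ a → Op¹ H a → ∀ b → Op¹ H b → γ a < b → b < a →
                         val b ≡ val a → γ b ≡ γ a
    γ-unique-between-γ a op b op-b γa<b b<a vb≡va with <-cmp (γ b) (γ a)
    ... | tri≈ _ γb≡γa _ = γb≡γa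
    ... | tri< γb<γa _ _ = ⊥-elim
      (no-Op⁰-between-γ b op-b (γ a) γb<γa γa<b (γ-Op⁰ a op)
        (trans (val-γ a op) (sym vb≡va)))
    ... | tri> _ _ γa<γb = ⊥-elim
      (no-Op⁰-between-γ a op (γ b) γa<γb (<-trans (γ-<-self b op-b) b<a)
        (γ-Op⁰ b op-b) (trans (val-γ b op-b) vb≡va))

    FS1-clause⇒FS1-clause-strong : FS1-clause-strong H γ
    FS1-clause⇒FS1-clause-strong a op (b , rem-b , χb≢sf , γa<b , b<a , vb≡va)
      with χ b in χb
    ... | sf = χb≢sf refl
    ... | s0 = no-Op⁰-between-γ a op b γa<b b<a χb vb≡va
    ... | s1 = clause a op (b , (rem-b , χb) ,
                 γ-unique-between-γ a op b χb γa<b b<a vb≡va , γa<b , b<a)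

lemma2p2 : (H : History) (γ : ℕ → ℕ) →
    (FS0 H γ → FS1-base H γ → FS2 H γ →
      FS1-clause H γ ⇔ FS1-clause-strong H γ)
    × (FS0 H γ → FS1 H γ → FS2 H γ → FS1-clause-strong H γ)
lemma2p2 H γ =
    (λ _ base fs2 → mk⇔ (FS1-clause⇒FS1-clause-strong H γ base fs2)
                        (FS1-clause-strong⇒FS1-clause H γ base))
  , (λ _ (base , clause) fs2 → FS1-clause⇒FS1-clause-strong H γ base fs2 clause)
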